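{- Fix an integer $k\ge 2$ and a formal variable $q$. Let $G_s$, $s\ge 1$, be the formal series defined by $$G_i=\prod_{\substack{n\ge 1\\ n\not\equiv 0,\,\pm(k+1-i)\ (\mathrm{mod}\ 2k+1)}}\frac{1}{1-q^n}\quad (i=1,\dots,k),$$ $$G_{(k-1)j+i}=\frac{G_{(k-1)(j-1)+k-i+1}-G_{(k-1)(j-1)+k-i+2}}{q^{(i-1)j}}\quad (j\ge 1,\ i=2,\dots,k).$$ For $j\ge 1$ let $\mathbf{A}_{(j)}$ be the $k\times k$ matrix whose $(r,c)$ entry is $q^{(c-1)j}$ if $r+c\le k+1$ and $0$ otherwise. Define $k\times k$ matrices $\mathbf{h}^{(j)}=({}_ih^{(j)}_l)_{1\le i,l\le k}$ by letting $\mathbf{h}^{(0)}$ be the identity matrix and, for $j\ge 1$ and each $i$, $${}_ih^{(j)}_l=\big({}_ih^{(j-1)}_1+\cdots+{}_ih^{(j-1)}_{k-l+1}\big)\,q^{(l-1)j},\qquad 1\le l\le k.$$ Then for every $j\ge 0$: the entries of $\mathbf{h}^{(j)}$ are polynomials in $q$ with nonnegative integer coefficients; $\mathbf{h}^{(j)}=\mathbf{h}^{(j-1)}\mathbf{A}_{(j)}$ for $j\ge1$, so that $\mathbf{h}^{(j)}=\mathbf{A}_{(1)}\mathbf{A}_{(2)}\cdots\mathbf{A}_{(j)}$; and for each $i=1,\dots,k$, $$G_i={}_ih^{(j)}_1\,G_{(k-1)j+1}+\cdots+{}_ih^{(j)}_k\,G_{(k-1)j+k}.$$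
   Context: In the paper, the polynomials ${}_ih^{(j)}_l$ are defined as the coefficients obtained by repeatedly rewriting $G_1,\dots,G_k$ in terms of $G_{(k-1)j+1},\dots,G_{(k-1)j+k}$ using the defining recursion, and the proposition asserts that they satisfy the stated recursion; the formulation above records this by defining them via the recursion and asserting the resulting expansion of $G_i$. -}

module Defs where

open import Data.Nat as ℕ using (ℕ; zero; suc; _∸_; _%_; _≡ᵇ_; _≤ᵇ_)
open import Data.Bool using (Bool; true; false; if_then_else_; not; _∨_)
open import Data.Integer as ℤ using (ℤ; 0ℤ; 1ℤ; _≤_)
open import Data.Product using (Σ; _×_; _,_)
open import Relation.Binary.PropositionalEquality using (_≡_)

-- Formal power series in q with integer coefficients:
-- a series is its coefficient function (coefficient of q^n).

Series : Set
Series = ℕ → ℤ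

_≐_ : Series → Series → Set
f ≐ g = ∀ n → f n ≡ g n

infix 4 _≐_

zeroS : Series
zeroS _ = 0ℤ

mono : ℕ → Series
mono m n = if n ≡ᵇ m then 1ℤ else 0ℤ

oneS : Series
oneS = mono 0

_+S_ : Series → Series → Series
(f +S g) n = f n ℤ.+ g n

_-S_ : Series → Series → Series
(f -S g) n = f n ℤ.- g n

sumBelow : ℕ → (ℕ → ℤ) → ℤ
sumBelow zero    f = 0ℤ
sumBelow (suc n) f = sumBelow n f ℤ.+ f n

_*S_ : Series → Series → Series
(f *S g) n = sumBelow (suc n) (λ a → f a ℤ.* g (n ∸ a))

shift : ℕ → Series → Series
shift zero    f n       = f n
shift (suc m) f zero    = 0ℤ
shift (suc m) f (suc n) = shift m f n

sumS : ℕ → (ℕ → Series) → Series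
sumS zero    F = zeroS
sumS (suc n) F = sumS n F +S F (suc n)

IsNNPoly : Series → Set
IsNNPoly f = Σ ℕ (λ D → (∀ n → D ℕ.≤ n → f n ≡ 0ℤ)) × (∀ n → 0ℤ ≤ f n)

-- Laurent series with bounded-below support, represented as f / q^e.

record Laurent : Set where
  constructor _/q^_
  field
    num : Series
    ex  : ℕ
open Laurent public

_≈L_ : Laurent → Laurent → Set
(f /q^ e) ≈L (g /q^ e') = shift e' f ≐ shift e g

infix 4 _≈L_

zeroL : Laurent
zeroL = zeroS /q^ 0

_+L_ : Laurent → Laurent → Laurent
(f /q^ e) +L (g /q^ e') = (shift e' f +S shift e g) /q^ (e ℕ.+ e')

_-L_ : Laurent → Laurent → Laurent
(f /q^ e) -L (g /q^ e') = (shift e' f -S shift e g) /q^ (e ℕ.+ e')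

divq : ℕ → Laurent → Laurent
divq m (f /q^ e) = f /q^ (e ℕ.+ m)

_·L_ : Series → Laurent → Laurent
p ·L (f /q^ e) = (p *S f) /q^ e

sumL : ℕ → (ℕ → Laurent) → Laurent
sumL zero    F = zeroL
sumL (suc n) F = sumL n F +L F (suc n)

-- 1/(1 - q^(suc d)) = Σ_m q^{(suc d) m}
geom : ℕ → Series
geom d m = if (m % suc d) ≡ᵇ 0 then 1ℤ else 0ℤ

-- n (≥ 1) is allowed in the product for G_i iff
-- n ≢ 0, ±(k+1-i) (mod 2k+1); note -(k+1-i) ≡ k+i (mod 2k+1).
allowed : ℕ → ℕ → ℕ → Bool
allowed k i n =
  let r = n % suc (2 ℕ.* k) in
  not ((r ≡ᵇ 0) ∨ (r ≡ᵇ (suc k ∸ i)) ∨ (r ≡ᵇ (k ℕ.+ i)))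

prodUpTo : ℕ → ℕ → ℕ → Series
prodUpTo k i zero    = oneS
prodUpTo k i (suc d) =
  prodUpTo k i d *S (if allowed k i (suc d) then geom d else oneS)

-- the infinite product: its q^N coefficient equals that of the
-- finite product over n ≤ N (factors with n > N are ≡ 1 mod q^{N+1})
Gprod : ℕ → ℕ → Series
Gprod k i N = prodUpTo k i N N

-- G_s, organised in blocks: block k j l = G_{(k-1)j+l}, 1 ≤ l ≤ k.
-- (Indices outside 1..k are junk and never used.)

block : ℕ → ℕ → ℕ → Laurent
block k zero          i             = Gprod k i /q^ 0
block k (suc j)       zero          = zeroL
block k (suc j)       (suc zero)    = block k j k
block k (suc j) i@(suc (suc i')) =
  divq (suc i' ℕ.* suc j)
       (block k j (suc (k ∸ i)) -L block k j (suc (suc (k ∸ i))))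

-- The matrices A_(j) and h^(j) (1-based indices 1..k).

Mat : Set
Mat = ℕ → ℕ → Series

A : ℕ → ℕ → Mat
A k j r c = if (r ℕ.+ c) ≤ᵇ suc k then mono ((c ∸ 1) ℕ.* j) else zeroS

idM : Mat
idM r c = if r ≡ᵇ c then oneS else zeroS

matMul : ℕ → Mat → Mat → Mat
matMul k M N r c = sumS k (λ m → M r m *S N m c)

Aprod : ℕ → ℕ → Mat
Aprod k zero    = idM
Aprod k (suc j) = matMul k (Aprod k j) (A k (suc j))

h : ℕ → ℕ → Mat
h k zero    i l = idM i l
h k (suc j) i l =
  shift ((l ∸ 1) ℕ.* suc j) (sumS (suc k ∸ l) (λ m → h k j i m))

-- Write G_{j,l} for G_{(k-1)j+l}. Inverting the defining recursion, each block
-- entry is a telescoping sum of the next block: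
--   G_{j,k+1-p} = Σ_{l ≤ p} q^{(l-1)(j+1)} G_{j+1,l}   (1 ≤ p ≤ k),
-- that is, the column (G_{j,m})_m equals A_(j+1) (G_{j+1,l})_l. Hence
-- Σ_m h^(j)_{im} G_{j,m} = Σ_l (h^(j) A_(j+1))_{il} G_{j+1,l}, and the recursion for
-- h^(j+1) is exactly the matrix product h^(j) A_(j+1), since A_(j+1) is a triangle of
-- monomials. The G_s are Laurent series; every identity is checked after multiplying
-- by a power q^N large enough to clear all denominators.
module Submission where

open import Defs
open import Data.Nat using (ℕ; _≤_; _∸_)
open import Data.Product using (_×_)
open import Data.Nat as ℕ using (zero; suc; _+_; _*_; _<_; _≤ᵇ_; _≡ᵇ_; _≤?_; _≟_; z≤n; s≤s)
open import Data.Nat.Properties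
  using ( ≤-refl; ≤-trans; ≤-reflexive; ≤-antisym; <⇒≢; >⇒≢; <⇒≤; <⇒≱; ≰⇒>; <-≤-trans
        ; m<n⇒m<1+n; m≤n⇒m≤1+n; n≤1+n; +-comm; +-suc; +-identityʳ; +-mono-≤; +-monoˡ-≤
        ; *-monoˡ-≤; +-cancelˡ-≤; m≤m+n; m≤n+m; +-∸-assoc; m+[n∸m]≡n; m∸n≤m; n∸n≡0
        ; m<n⇒0<n∸m; m∸[m∸n]≡n; m≤o∸n⇒m+n≤o; m+n≤o⇒m≤o∸n; m≤m⊔n; m≤n⊔m; m≤n⇒∃[o]m+o≡n )
import Data.Nat.Tactic.RingSolver as ℕ-Solver
open import Data.Integer as ℤ using (ℤ; 0ℤ)
import Data.Integer.Properties as ℤₚ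
open import Data.Integer.Tactic.RingSolver using (solve-∀)
open import Algebra.Properties.CommutativeSemigroup ℤₚ.+-commutativeSemigroup using (interchange)
open import Data.Bool using (Bool; true; false; if_then_else_)
open import Data.Product using (_,_)
open import Relation.Nullary using (yes; no)
open import Relation.Nullary.Decidable using (dec-true; dec-false)
open import Relation.Binary using (Setoid)
open import Relation.Binary.PropositionalEquality using (_≡_; refl; sym; trans; cong; cong₂; _→-setoid_)
open Setoid (ℕ →-setoid ℤ) using () renaming (refl to ≐-refl; sym to ≐-sym; trans to ≐-trans)
open import Relation.Binary.Reasoning.Setoid (ℕ →-setoid ℤ)

-- Power series arithmetic

sumBelow-cong : ∀ n {f g} → (∀ a → a < n → f a ≡ g a) → sumBelow n f ≡ sumBelow n g
sumBelow-cong zero    f≡g = refl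
sumBelow-cong (suc n) f≡g =
  cong₂ ℤ._+_ (sumBelow-cong n (λ a a<n → f≡g a (m<n⇒m<1+n a<n))) (f≡g n ≤-refl)

sumBelow-zero : ∀ n {f} → (∀ a → a < n → f a ≡ 0ℤ) → sumBelow n f ≡ 0ℤ
sumBelow-zero zero    f≡0 = refl
sumBelow-zero (suc n) f≡0 =
  cong₂ ℤ._+_ (sumBelow-zero n (λ a a<n → f≡0 a (m<n⇒m<1+n a<n))) (f≡0 n ≤-refl)

sumBelow-suc-front : ∀ n f → sumBelow (suc n) f ≡ f 0 ℤ.+ sumBelow n (λ a → f (suc a))
sumBelow-suc-front zero    f = trans (ℤₚ.+-identityˡ (f 0)) (sym (ℤₚ.+-identityʳ (f 0)))
sumBelow-suc-front (suc n) f =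
  trans (cong (ℤ._+ f (suc n)) (sumBelow-suc-front n f)) (ℤₚ.+-assoc (f 0) _ _)

sumBelow-+ : ∀ n f g → sumBelow n (λ a → f a ℤ.+ g a) ≡ sumBelow n f ℤ.+ sumBelow n g
sumBelow-+ zero    f g = refl
sumBelow-+ (suc n) f g =
  trans (cong (ℤ._+ (f n ℤ.+ g n)) (sumBelow-+ n f g)) (interchange (sumBelow n f) (sumBelow n g) (f n) (g n))

+S-cong : ∀ {f f′ g g′} → f ≐ f′ → g ≐ g′ → f +S g ≐ f′ +S g′
+S-cong f≐f′ g≐g′ n = cong₂ ℤ._+_ (f≐f′ n) (g≐g′ n)

+S-identityˡ : ∀ f → zeroS +S f ≐ f
+S-identityˡ f n = ℤₚ.+-identityˡ (f n)

+S-identityʳ : ∀ f → f +S zeroS ≐ f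
+S-identityʳ f n = ℤₚ.+-identityʳ (f n)

*S-congˡ : ∀ f {g g′} → g ≐ g′ → f *S g ≐ f *S g′
*S-congˡ f g≐g′ n = sumBelow-cong (suc n) (λ a _ → cong (f a ℤ.*_) (g≐g′ (n ∸ a)))

*S-congʳ : ∀ g {f f′} → f ≐ f′ → f *S g ≐ f′ *S g
*S-congʳ g f≐f′ n = sumBelow-cong (suc n) (λ a _ → cong (ℤ._* g (n ∸ a)) (f≐f′ a))

*S-zeroˡ : ∀ g → zeroS *S g ≐ zeroS
*S-zeroˡ g n = sumBelow-zero (suc n) (λ _ _ → refl)

*S-zeroʳ : ∀ f → f *S zeroS ≐ zeroS
*S-zeroʳ f n = sumBelow-zero (suc n) (λ a _ → ℤₚ.*-zeroʳ (f a))

*S-identityˡ : ∀ g → oneS *S g ≐ g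
*S-identityˡ g n = trans (sumBelow-suc-front n _)
  (trans (cong₂ ℤ._+_ (ℤₚ.*-identityˡ (g n)) (sumBelow-zero n (λ _ _ → refl))) (ℤₚ.+-identityʳ (g n)))

*S-identityʳ : ∀ f → f *S oneS ≐ f
*S-identityʳ f n =
  trans (cong₂ ℤ._+_ (sumBelow-zero n below) last) (ℤₚ.+-identityˡ (f n))
  where
  oneS-pos : ∀ m → 0 < m → oneS m ≡ 0ℤ
  oneS-pos (suc m) _ = refl
  below : ∀ a → a < n → f a ℤ.* oneS (n ∸ a) ≡ 0ℤ
  below a a<n = trans (cong (f a ℤ.*_) (oneS-pos (n ∸ a) (m<n⇒0<n∸m a<n))) (ℤₚ.*-zeroʳ (f a))
  last : f n ℤ.* oneS (n ∸ n) ≡ f n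
  last = trans (cong (λ t → f n ℤ.* oneS t) (n∸n≡0 n)) (ℤₚ.*-identityʳ (f n))

*S-distribˡ-+S : ∀ f g g′ → f *S (g +S g′) ≐ (f *S g) +S (f *S g′)
*S-distribˡ-+S f g g′ n = trans
  (sumBelow-cong (suc n) (λ a _ → ℤₚ.*-distribˡ-+ (f a) (g (n ∸ a)) (g′ (n ∸ a))))
  (sumBelow-+ (suc n) _ _)

*S-distribʳ-+S : ∀ f f′ g → (f +S f′) *S g ≐ (f *S g) +S (f′ *S g)
*S-distribʳ-+S f f′ g n = trans
  (sumBelow-cong (suc n) (λ a _ → ℤₚ.*-distribʳ-+ (g (n ∸ a)) (f a) (f′ a)))
  (sumBelow-+ (suc n) _ _)

shift-cong : ∀ c {f g} → f ≐ g → shift c f ≐ shift c g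
shift-cong zero    f≐g n       = f≐g n
shift-cong (suc c) f≐g zero    = refl
shift-cong (suc c) f≐g (suc n) = shift-cong c f≐g n

shift-below : ∀ c f n → n < c → shift c f n ≡ 0ℤ
shift-below (suc c) f zero    _         = refl
shift-below (suc c) f (suc n) (s≤s n<c) = shift-below c f n n<c

shift-at : ∀ c f n → shift c f (c + n) ≡ f n
shift-at zero    f n = refl
shift-at (suc c) f n = shift-at c f n

shift-+ˡ : ∀ d c f n → shift (d + c) f (d + n) ≡ shift c f n
shift-+ˡ zero    c f n = refl
shift-+ˡ (suc d) c f n = shift-+ˡ d c f n

shift-shift : ∀ a b f → shift a (shift b f) ≐ shift (a + b) f
shift-shift zero    b f n       = refl
shift-shift (suc a) b f zero    = refl
shift-shift (suc a) b f (suc n) = shift-shift a b f n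

shift-injective : ∀ c {f g} → shift c f ≐ shift c g → f ≐ g
shift-injective c {f} {g} eq n = trans (sym (shift-at c f n)) (trans (eq (c + n)) (shift-at c g n))

shift-zeroS : ∀ c → shift c zeroS ≐ zeroS
shift-zeroS zero    n       = refl
shift-zeroS (suc c) zero    = refl
shift-zeroS (suc c) (suc n) = shift-zeroS c n

shift-zip : ∀ (_∙_ : ℤ → ℤ → ℤ) → 0ℤ ∙ 0ℤ ≡ 0ℤ → ∀ c f g →
  shift c (λ n → f n ∙ g n) ≐ (λ n → shift c f n ∙ shift c g n)
shift-zip _∙_ 0∙0 zero    f g n       = refl
shift-zip _∙_ 0∙0 (suc c) f g zero    = sym 0∙0
shift-zip _∙_ 0∙0 (suc c) f g (suc n) = shift-zip _∙_ 0∙0 c f g n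

shift-+S : ∀ c f g → shift c (f +S g) ≐ shift c f +S shift c g
shift-+S = shift-zip ℤ._+_ refl

shift-unshift : ∀ c s → (∀ n → n < c → s n ≡ 0ℤ) → shift c (λ n → s (n + c)) ≐ s
shift-unshift zero    s _   n       = cong s (+-identityʳ n)
shift-unshift (suc c) s s≡0 zero    = sym (s≡0 0 (s≤s z≤n))
shift-unshift (suc c) s s≡0 (suc n) = trans
  (shift-cong c (λ m → cong s (+-suc m c)) n)
  (shift-unshift c (λ m → s (suc m)) (λ m m<c → s≡0 (suc m) (s≤s m<c)) n)

shift-*Sˡ : ∀ c f g → shift c f *S g ≐ shift c (f *S g)
shift-*Sˡ zero    f g n       = refl
shift-*Sˡ (suc c) f g zero    = refl
shift-*Sˡ (suc c) f g (suc n) =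
  trans (sumBelow-suc-front (suc n) _) (trans (ℤₚ.+-identityˡ _) (shift-*Sˡ c f g n))

shift-*Sʳ : ∀ c f g → f *S shift c g ≐ shift c (f *S g)
shift-*Sʳ zero    f g n       = refl
shift-*Sʳ (suc c) f g zero    = trans (ℤₚ.+-identityˡ _) (ℤₚ.*-zeroʳ (f 0))
shift-*Sʳ (suc c) f g (suc n) = trans
  (cong₂ ℤ._+_ (sumBelow-cong (suc n) inner) last)
  (trans (ℤₚ.+-identityʳ _) (shift-*Sʳ c f g n))
  where
  inner : ∀ a → a < suc n → f a ℤ.* shift (suc c) g (suc n ∸ a) ≡ f a ℤ.* shift c g (n ∸ a)
  inner a (s≤s a≤n) = cong (λ t → f a ℤ.* shift (suc c) g t) (+-∸-assoc 1 a≤n)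
  last : f (suc n) ℤ.* shift (suc c) g (n ∸ n) ≡ 0ℤ
  last = trans (cong (λ t → f (suc n) ℤ.* shift (suc c) g t) (n∸n≡0 n)) (ℤₚ.*-zeroʳ (f (suc n)))

mono≐shift-oneS : ∀ c → mono c ≐ shift c oneS
mono≐shift-oneS zero    n       = refl
mono≐shift-oneS (suc c) zero    = refl
mono≐shift-oneS (suc c) (suc n) = mono≐shift-oneS c n

mono-*S : ∀ c g → mono c *S g ≐ shift c g
mono-*S c g = begin
  mono c *S g           ≈⟨ *S-congʳ g (mono≐shift-oneS c) ⟩
  shift c oneS *S g     ≈⟨ shift-*Sˡ c oneS g ⟩
  shift c (oneS *S g)   ≈⟨ shift-cong c (*S-identityˡ g) ⟩
  shift c g             ∎

*S-mono : ∀ c f → f *S mono c ≐ shift c f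
*S-mono c f = begin
  f *S mono c           ≈⟨ *S-congˡ f (mono≐shift-oneS c) ⟩
  f *S shift c oneS     ≈⟨ shift-*Sʳ c f oneS ⟩
  shift c (f *S oneS)   ≈⟨ shift-cong c (*S-identityʳ f) ⟩
  shift c f             ∎

*S-assoc-mono : ∀ c f g → f *S (mono c *S g) ≐ (f *S mono c) *S g
*S-assoc-mono c f g = begin
  f *S (mono c *S g)    ≈⟨ *S-congˡ f (mono-*S c g) ⟩
  f *S shift c g        ≈⟨ shift-*Sʳ c f g ⟩
  shift c (f *S g)      ≈⟨ shift-*Sˡ c f g ⟨
  shift c f *S g        ≈⟨ *S-congʳ g (*S-mono c f) ⟨
  (f *S mono c) *S g    ∎

sumS-cong : ∀ n {F G} → (∀ l → 1 ≤ l → l ≤ n → F l ≐ G l) → sumS n F ≐ sumS n G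
sumS-cong zero    F≐G = ≐-refl
sumS-cong (suc n) F≐G =
  +S-cong (sumS-cong n (λ l 1≤l l≤n → F≐G l 1≤l (m≤n⇒m≤1+n l≤n))) (F≐G (suc n) (s≤s z≤n) ≤-refl)

sumS-zero : ∀ n {F} → (∀ l → 1 ≤ l → l ≤ n → F l ≐ zeroS) → sumS n F ≐ zeroS
sumS-zero zero    F≐0 = ≐-refl
sumS-zero (suc n) F≐0 =
  +S-cong (sumS-zero n (λ l 1≤l l≤n → F≐0 l 1≤l (m≤n⇒m≤1+n l≤n))) (F≐0 (suc n) (s≤s z≤n) ≤-refl)

sumS-+S : ∀ n (F G : ℕ → Series) → sumS n (λ l → F l +S G l) ≐ sumS n F +S sumS n G
sumS-+S zero    F G m = refl
sumS-+S (suc n) F G m =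
  trans (cong (ℤ._+ (F (suc n) m ℤ.+ G (suc n) m)) (sumS-+S n F G m)) (interchange (sumS n F m) (sumS n G m) (F (suc n) m) (G (suc n) m))

sumS-swap : ∀ n p (F : ℕ → ℕ → Series) → sumS n (λ m → sumS p (λ l → F m l)) ≐ sumS p (λ l → sumS n (λ m → F m l))
sumS-swap zero    p F = ≐-sym (sumS-zero p (λ _ _ _ → ≐-refl))
sumS-swap (suc n) p F = ≐-trans
  (+S-cong (sumS-swap n p F) ≐-refl)
  (≐-sym (sumS-+S p (λ l → sumS n (λ m → F m l)) (F (suc n))))

*S-sumS : ∀ n f (G : ℕ → Series) → f *S sumS n G ≐ sumS n (λ l → f *S G l)
*S-sumS zero    f G = *S-zeroʳ f
*S-sumS (suc n) f G = ≐-trans (*S-distribˡ-+S f (sumS n G) (G (suc n))) (+S-cong (*S-sumS n f G) ≐-refl)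

sumS-*S : ∀ n (F : ℕ → Series) g → sumS n F *S g ≐ sumS n (λ l → F l *S g)
sumS-*S zero    F g = *S-zeroˡ g
sumS-*S (suc n) F g = ≐-trans (*S-distribʳ-+S (sumS n F) (F (suc n)) g) (+S-cong (sumS-*S n F g) ≐-refl)

shift-sumS : ∀ c n (F : ℕ → Series) → shift c (sumS n F) ≐ sumS n (λ l → shift c (F l))
shift-sumS c zero    F = shift-zeroS c
shift-sumS c (suc n) F = ≐-trans (shift-+S c (sumS n F) (F (suc n))) (+S-cong (shift-sumS c n F) ≐-refl)

-- The entries of idM and of A are guarded monomials, definitionally.
guard : Bool → Series → Series
guard b f = if b then f else zeroS

guard-cong : ∀ b {f g} → f ≐ g → guard b f ≐ guard b g
guard-cong true  f≐g = f≐g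
guard-cong false f≐g = ≐-refl

guard-true : ∀ {b} f → b ≡ true → guard b f ≐ f
guard-true f refl = ≐-refl

guard-false : ∀ {b} f → b ≡ false → guard b f ≐ zeroS
guard-false f refl = ≐-refl

guard-*S : ∀ b f g → guard b f *S g ≐ guard b (f *S g)
guard-*S true  f g = ≐-refl
guard-*S false f g = *S-zeroˡ g

*S-guard : ∀ b f g → f *S guard b g ≐ guard b (f *S g)
*S-guard true  f g = ≐-refl
*S-guard false f g = *S-zeroʳ f

*S-assoc-guard-mono : ∀ b c f g → f *S (guard b (mono c) *S g) ≐ (f *S guard b (mono c)) *S g
*S-assoc-guard-mono true  c f g = *S-assoc-mono c f g
*S-assoc-guard-mono false c f g = begin
  f *S (zeroS *S g)   ≈⟨ *S-congˡ f (*S-zeroˡ g) ⟩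
  f *S zeroS          ≈⟨ *S-zeroʳ f ⟩
  zeroS               ≈⟨ *S-zeroˡ g ⟨
  zeroS *S g          ≈⟨ *S-congʳ g (*S-zeroʳ f) ⟨
  (f *S zeroS) *S g   ∎

sumS-guard-prefix : ∀ n t (P : ℕ → Bool) (F : ℕ → Series) → t ≤ n →
  (∀ l → 1 ≤ l → l ≤ t → P l ≡ true) → (∀ l → t < l → l ≤ n → P l ≡ false) →
  sumS n (λ l → guard (P l) (F l)) ≐ sumS t F
sumS-guard-prefix zero    zero P F _   _    _     = ≐-refl
sumS-guard-prefix (suc n) t    P F t≤n+1 Ptrue Pfalse with t ≤? n
... | yes t≤n = ≐-trans
      (+S-cong (sumS-guard-prefix n t P F t≤n Ptrue (λ l t<l l≤n → Pfalse l t<l (m≤n⇒m≤1+n l≤n)))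
               (guard-false (F (suc n)) (Pfalse (suc n) (s≤s t≤n) ≤-refl)))
      (+S-identityʳ (sumS t F))
... | no t≰n with ≤-antisym t≤n+1 (≰⇒> t≰n)
...   | refl = sumS-cong (suc n) (λ l 1≤l l≤t → guard-true (F l) (Ptrue l 1≤l l≤t))

sumS-guard-≡ᵇ : ∀ n i (G : ℕ → Series) → 1 ≤ i → i ≤ n → sumS n (λ l → guard (i ≡ᵇ l) (G l)) ≐ G i
sumS-guard-≡ᵇ zero    zero G () _
sumS-guard-≡ᵇ (suc n) i G 1≤i i≤n+1 with i ≤? n
... | yes i≤n = ≐-trans
      (+S-cong (sumS-guard-≡ᵇ n i G 1≤i i≤n)
               (guard-false (G (suc n)) (dec-false (i ≟ suc n) (<⇒≢ (s≤s i≤n)))))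
      (+S-identityʳ (G i))
... | no i≰n with ≤-antisym i≤n+1 (≰⇒> i≰n)
...   | refl = ≐-trans
      (+S-cong (sumS-zero n (λ l _ l≤n → guard-false (G l) (dec-false (suc n ≟ l) (>⇒≢ (s≤s l≤n)))))
               (guard-true (G (suc n)) (dec-true (suc n ≟ suc n) refl)))
      (+S-identityˡ (G (suc n)))

sumS-guard-≤ᵇ : ∀ k l (F : ℕ → Series) → 1 ≤ l → l ≤ suc k →
  sumS k (λ m → guard ((m + l) ≤ᵇ suc k) (F m)) ≐ sumS (suc k ∸ l) F
sumS-guard-≤ᵇ k l@(suc l′) F _ l≤k+1 = sumS-guard-prefix k (suc k ∸ l) (λ m → (m + l) ≤ᵇ suc k) F (m∸n≤m k l′)
  (λ m _ m≤ → dec-true (m + l ≤? suc k) (m≤o∸n⇒m+n≤o m l≤k+1 m≤))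
  (λ m <m _ → dec-false (m + l ≤? suc k) (λ m+l≤ → <⇒≱ <m (m+n≤o⇒m≤o∸n m m+l≤)))

-- The matrices h^(j)

h-suc≐h*A : ∀ k j i l → 1 ≤ l → l ≤ k → h k (suc j) i l ≐ matMul k (h k j) (A k (suc j)) i l
h-suc≐h*A k j i l 1≤l l≤k = begin
  shift c (sumS (suc k ∸ l) (h k j i))
    ≈⟨ shift-sumS c (suc k ∸ l) (h k j i) ⟩
  sumS (suc k ∸ l) (λ m → shift c (h k j i m))
    ≈⟨ sumS-guard-≤ᵇ k l (λ m → shift c (h k j i m)) 1≤l (m≤n⇒m≤1+n l≤k) ⟨
  sumS k (λ m → guard ((m + l) ≤ᵇ suc k) (shift c (h k j i m)))
    ≈⟨ sumS-cong k (λ m _ _ → ≐-trans (*S-guard ((m + l) ≤ᵇ suc k) (h k j i m) (mono c))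
                                     (guard-cong ((m + l) ≤ᵇ suc k) (*S-mono c (h k j i m)))) ⟨
  matMul k (h k j) (A k (suc j)) i l
    ∎
  where
  c : ℕ
  c = (l ∸ 1) * suc j

h≐Aprod : ∀ k j i l → 1 ≤ l → l ≤ k → h k j i l ≐ Aprod k j i l
h≐Aprod k zero    i l _   _   = ≐-refl
h≐Aprod k (suc j) i l 1≤l l≤k = ≐-trans
  (h-suc≐h*A k j i l 1≤l l≤k)
  (sumS-cong k (λ m 1≤m m≤k → *S-congʳ (A k (suc j) m l) (h≐Aprod k j i m 1≤m m≤k)))

IsNNPoly-zeroS : IsNNPoly zeroS
IsNNPoly-zeroS = (0 , λ _ _ → refl) , λ _ → ℤₚ.≤-refl

IsNNPoly-oneS : IsNNPoly oneS
IsNNPoly-oneS = (1 , λ { (suc n) _ → refl }) , λ { zero → ℤ.+≤+ z≤n ; (suc n) → ℤₚ.≤-refl }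

IsNNPoly-guard : ∀ b {f} → IsNNPoly f → IsNNPoly (guard b f)
IsNNPoly-guard true  nn = nn
IsNNPoly-guard false nn = IsNNPoly-zeroS

IsNNPoly-+S : ∀ {f g} → IsNNPoly f → IsNNPoly g → IsNNPoly (f +S g)
IsNNPoly-+S ((D , f≡0) , 0≤f) ((E , g≡0) , 0≤g) =
  (D ℕ.⊔ E , λ n D⊔E≤n → cong₂ ℤ._+_ (f≡0 n (≤-trans (m≤m⊔n D E) D⊔E≤n)) (g≡0 n (≤-trans (m≤n⊔m D E) D⊔E≤n))) ,
  λ n → ℤₚ.+-mono-≤ (0≤f n) (0≤g n)

IsNNPoly-shift : ∀ c {f} → IsNNPoly f → IsNNPoly (shift c f)
IsNNPoly-shift c {f} ((D , f≡0) , 0≤f) = (c + D , vanish c) , nonneg c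
  where
  vanish : ∀ c n → c + D ≤ n → shift c f n ≡ 0ℤ
  vanish zero    n       D≤n      = f≡0 n D≤n
  vanish (suc c) (suc n) (s≤s le) = vanish c n le
  nonneg : ∀ c n → 0ℤ ℤ.≤ shift c f n
  nonneg zero    n       = 0≤f n
  nonneg (suc c) zero    = ℤₚ.≤-refl
  nonneg (suc c) (suc n) = nonneg c n

IsNNPoly-sumS : ∀ n {F} → (∀ l → IsNNPoly (F l)) → IsNNPoly (sumS n F)
IsNNPoly-sumS zero    nn = IsNNPoly-zeroS
IsNNPoly-sumS (suc n) nn = IsNNPoly-+S (IsNNPoly-sumS n nn) (nn (suc n))

h-IsNNPoly : ∀ k j i l → IsNNPoly (h k j i l)
h-IsNNPoly k zero    i l = IsNNPoly-guard (i ≡ᵇ l) IsNNPoly-oneS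
h-IsNNPoly k (suc j) i l =
  IsNNPoly-shift ((l ∸ 1) * suc j) (IsNNPoly-sumS (suc k ∸ l) (h-IsNNPoly k j i))

-- Clearing denominators

-- q^N · x; a power series exactly when ex x ≤ N (below that its low terms are cut off).
clear : ℕ → Laurent → Series
clear N x n = shift N (num x) (n + ex x)

clear-ex+ : ∀ r x → clear (ex x + r) x ≐ shift r (num x)
clear-ex+ r x n = trans (cong (shift (ex x + r) (num x)) (+-comm n (ex x))) (shift-+ˡ (ex x) r (num x) n)

clear-rescale : ∀ N b f e → clear N (shift b f /q^ (e + b)) ≐ clear N (f /q^ e)
clear-rescale N b f e n = trans (shift-shift N b f (n + (e + b)))
  (trans (cong₂ (λ a m → shift a f m) (+-comm N b) (arith n e b)) (shift-+ˡ b N f (n + e)))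
  where
  arith : ∀ n e b → n + (e + b) ≡ b + (n + e)
  arith = ℕ-Solver.solve-∀

clear-zip : ∀ (_∙_ : ℤ → ℤ → ℤ) → 0ℤ ∙ 0ℤ ≡ 0ℤ → ∀ N x y →
  clear N ((λ n → shift (ex y) (num x) n ∙ shift (ex x) (num y) n) /q^ (ex x + ex y))
    ≐ (λ n → clear N x n ∙ clear N y n)
clear-zip _∙_ 0∙0 N x y n = trans
  (shift-zip _∙_ 0∙0 N (shift (ex y) (num x)) (shift (ex x) (num y)) (n + (ex x + ex y)))
  (cong₂ _∙_ (clear-rescale N (ex y) (num x) (ex x) n)
             (trans (cong (λ e → shift N (shift (ex x) (num y)) (n + e)) (+-comm (ex x) (ex y)))
                    (clear-rescale N (ex x) (num y) (ex y) n)))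

clear-+L : ∀ N x y → clear N (x +L y) ≐ clear N x +S clear N y
clear-+L = clear-zip ℤ._+_ refl

clear--L : ∀ N x y → clear N (x -L y) ≐ clear N x -S clear N y
clear--L = clear-zip ℤ._-_ refl

clear-sumL : ∀ N n (F : ℕ → Laurent) → clear N (sumL n F) ≐ sumS n (λ l → clear N (F l))
clear-sumL N zero    F m = shift-zeroS N (m + 0)
clear-sumL N (suc n) F = ≐-trans (clear-+L N (sumL n F) (F (suc n))) (+S-cong (clear-sumL N n F) ≐-refl)

clear-·L : ∀ N p x → ex x ≤ N → clear N (p ·L x) ≐ p *S clear N x
clear-·L N p x ex≤N with m≤n⇒∃[o]m+o≡n ex≤N
... | r , refl = begin
  clear (ex x + r) (p ·L x)    ≈⟨ clear-ex+ r (p ·L x) ⟩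
  shift r (p *S num x)         ≈⟨ shift-*Sʳ r p (num x) ⟨
  p *S shift r (num x)         ≈⟨ *S-congˡ p (clear-ex+ r x) ⟨
  p *S clear (ex x + r) x      ∎

clear-below : ∀ N c y n → ex y + c ≤ N → n < c → clear N y n ≡ 0ℤ
clear-below N c y n ex+c≤N n<c with m≤n⇒∃[o]m+o≡n (≤-trans (m≤m+n (ex y) c) ex+c≤N)
... | r , refl = trans (clear-ex+ r y n)
                       (shift-below r (num y) n (<-≤-trans n<c (+-cancelˡ-≤ (ex y) c r ex+c≤N)))

shift-clear-divq : ∀ N c y → ex y + c ≤ N → shift c (clear N (divq c y)) ≐ clear N y
shift-clear-divq N c y ex+c≤N = ≐-trans
  (shift-cong c (λ n → cong (shift N (num y)) (arith n (ex y) c)))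
  (shift-unshift c (clear N y) (λ n → clear-below N c y n ex+c≤N))
  where
  arith : ∀ n e c → n + (e + c) ≡ n + c + e
  arith = ℕ-Solver.solve-∀

≈L-fromClear : ∀ {x y} r → (∀ N → r ≤ N → clear N x ≐ clear N y) → x ≈L y
≈L-fromClear {x} {y} r clear≐ = shift-injective r (begin
  shift r (shift (ex y) (num x))    ≈⟨ shift-shift r (ex y) (num x) ⟩
  shift (r + ex y) (num x)          ≈⟨ (λ n → cong (λ a → shift a (num x) n) (+-comm r (ex y))) ⟩
  shift (ex y + r) (num x)          ≈⟨ clear-ex+ (ex y + r) x ⟨
  clear (ex x + (ex y + r)) x       ≈⟨ clear≐ _ (≤-trans (m≤n+m r (ex y)) (m≤n+m _ (ex x))) ⟩
  clear (ex x + (ex y + r)) y       ≈⟨ (λ n → cong (λ N → clear N y n) (arith (ex x) (ex y) r)) ⟩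
  clear (ex y + (ex x + r)) y       ≈⟨ clear-ex+ (ex x + r) y ⟩
  shift (ex x + r) (num y)          ≈⟨ (λ n → cong (λ a → shift a (num y) n) (+-comm (ex x) r)) ⟩
  shift (r + ex x) (num y)          ≈⟨ shift-shift r (ex x) (num y) ⟨
  shift r (shift (ex x) (num y))    ∎)
  where
  arith : ∀ a b c → a + (b + c) ≡ b + (a + c)
  arith = ℕ-Solver.solve-∀

-- The blocks G_{(k-1)j+l}

exBound : ℕ → ℕ → ℕ
exBound k zero    = 0
exBound k (suc j) = exBound k j + exBound k j + k * suc j

exBound-suc : ∀ k j → exBound k j ≤ exBound k (suc j)
exBound-suc k j = ≤-trans (m≤m+n (exBound k j) (exBound k j)) (m≤m+n _ _)

ex-block≤exBound : ∀ k j l → l ≤ k → ex (block k j l) ≤ exBound k j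
ex-block≤exBound k zero    l                 _   = z≤n
ex-block≤exBound k (suc j) zero              _   = z≤n
ex-block≤exBound k (suc j) (suc zero)        _   = ≤-trans (ex-block≤exBound k j k ≤-refl) (exBound-suc k j)
ex-block≤exBound k (suc j) l@(suc (suc l′)) l≤k = +-mono-≤
  (+-mono-≤ (ex-block≤exBound k j _ (≤-trans (n≤1+n _) upper)) (ex-block≤exBound k j _ upper))
  (*-monoˡ-≤ (suc j) (≤-trans (n≤1+n (suc l′)) l≤k))
  where
  upper : suc (suc (k ∸ l)) ≤ k
  upper = ≤-trans (+-monoˡ-≤ (k ∸ l) (s≤s (s≤s z≤n))) (≤-reflexive (m+[n∸m]≡n l≤k))

module _ (k j N : ℕ) (N-large : exBound k (suc j) ≤ N) where

  private
    G G′ : ℕ → Series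
    G  l = clear N (block k j l)
    G′ l = clear N (block k (suc j) l)

  clear-block-suc : ∀ p → 1 ≤ p → suc p ≤ k → shift (p * suc j) (G′ (suc p)) ≐ G (k ∸ p) -S G (suc k ∸ p)
  clear-block-suc p@(suc _) _ p<k = begin
    shift (p * suc j) (G′ (suc p))
      ≈⟨ shift-clear-divq N (p * suc j) _ (≤-trans (ex-block≤exBound k (suc j) (suc p) p<k) N-large) ⟩
    clear N (block k j (suc (k ∸ suc p)) -L block k j (suc (suc (k ∸ suc p))))
      ≈⟨ clear--L N _ _ ⟩
    G (suc (k ∸ suc p)) -S G (suc (suc (k ∸ suc p)))
      ≈⟨ (λ n → cong₂ (λ a b → G a n ℤ.- G b n) k+1-p-1≡k-p
                      (trans (cong suc k+1-p-1≡k-p) (sym (+-∸-assoc 1 (<⇒≤ p<k))))) ⟩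
    G (k ∸ p) -S G (suc k ∸ p)
      ∎
    where
    k+1-p-1≡k-p : suc (k ∸ suc p) ≡ k ∸ p
    k+1-p-1≡k-p = sym (+-∸-assoc 1 p<k)

  block-telescope : ∀ p → 1 ≤ p → p ≤ k → G (suc k ∸ p) ≐ sumS p (λ l → shift ((l ∸ 1) * suc j) (G′ l))
  block-telescope (suc zero)       _ _   = ≐-sym (+S-identityˡ (G k))
  block-telescope p@(suc (suc p′)) _ p≤k = begin
    G (k ∸ suc p′)
      ≈⟨ (λ n → u+[v-u]≡v (G (suc k ∸ suc p′) n) (G (k ∸ suc p′) n)) ⟨
    G (suc k ∸ suc p′) +S (G (k ∸ suc p′) -S G (suc k ∸ suc p′))
      ≈⟨ +S-cong (≐-sym (block-telescope (suc p′) (s≤s z≤n) (<⇒≤ p≤k))) (clear-block-suc (suc p′) (s≤s z≤n) p≤k) ⟨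
    sumS p (λ l → shift ((l ∸ 1) * suc j) (G′ l))
      ∎
    where
    u+[v-u]≡v : ∀ (u v : ℤ) → u ℤ.+ (v ℤ.- u) ≡ v
    u+[v-u]≡v = solve-∀

  block-expand : ∀ m → 1 ≤ m → m ≤ k → G m ≐ sumS k (λ l → A k (suc j) m l *S G′ l)
  block-expand m 1≤m m≤k = ≐-sym (begin
    sumS k (λ l → A k (suc j) m l *S G′ l)
      ≈⟨ sumS-cong k (λ l _ _ → ≐-trans (guard-*S ((m + l) ≤ᵇ suc k) (mono (c l)) (G′ l))
                                        (guard-cong ((m + l) ≤ᵇ suc k) (mono-*S (c l) (G′ l)))) ⟩
    sumS k (λ l → guard ((m + l) ≤ᵇ suc k) (shift (c l) (G′ l)))
      ≈⟨ sumS-cong k (λ l _ _ n → cong (λ t → guard (t ≤ᵇ suc k) (shift (c l) (G′ l)) n) (+-comm m l)) ⟩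
    sumS k (λ l → guard ((l + m) ≤ᵇ suc k) (shift (c l) (G′ l)))
      ≈⟨ sumS-guard-≤ᵇ k m (λ l → shift (c l) (G′ l)) 1≤m (m≤n⇒m≤1+n m≤k) ⟩
    sumS (suc k ∸ m) (λ l → shift (c l) (G′ l))
      ≈⟨ block-telescope (suc k ∸ m) (m<n⇒0<n∸m (s≤s m≤k)) (k+1-m≤k m 1≤m) ⟨
    G (suc k ∸ (suc k ∸ m))
      ≈⟨ (λ n → cong (λ t → G t n) (m∸[m∸n]≡n (m≤n⇒m≤1+n m≤k))) ⟩
    G m
      ∎)
    where
    c : ℕ → ℕ
    c l = (l ∸ 1) * suc j
    k+1-m≤k : ∀ m → 1 ≤ m → suc k ∸ m ≤ k
    k+1-m≤k (suc m′) _ = m∸n≤m k m′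

  expansion-step : ∀ i → sumS k (λ m → h k j i m *S G m) ≐ sumS k (λ l → h k (suc j) i l *S G′ l)
  expansion-step i = begin
    sumS k (λ m → h k j i m *S G m)
      ≈⟨ sumS-cong k (λ m 1≤m m≤k → *S-congˡ (h k j i m) (block-expand m 1≤m m≤k)) ⟩
    sumS k (λ m → h k j i m *S sumS k (λ l → A k (suc j) m l *S G′ l))
      ≈⟨ sumS-cong k (λ m _ _ → *S-sumS k (h k j i m) _) ⟩
    sumS k (λ m → sumS k (λ l → h k j i m *S (A k (suc j) m l *S G′ l)))
      ≈⟨ sumS-cong k (λ m _ _ → sumS-cong k (λ l _ _ →
           *S-assoc-guard-mono ((m + l) ≤ᵇ suc k) ((l ∸ 1) * suc j) (h k j i m) (G′ l))) ⟩
    sumS k (λ m → sumS k (λ l → (h k j i m *S A k (suc j) m l) *S G′ l))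
      ≈⟨ sumS-swap k k _ ⟩
    sumS k (λ l → sumS k (λ m → (h k j i m *S A k (suc j) m l) *S G′ l))
      ≈⟨ sumS-cong k (λ l _ _ → sumS-*S k _ (G′ l)) ⟨
    sumS k (λ l → matMul k (h k j) (A k (suc j)) i l *S G′ l)
      ≈⟨ sumS-cong k (λ l 1≤l l≤k → *S-congʳ (G′ l) (h-suc≐h*A k j i l 1≤l l≤k)) ⟨
    sumS k (λ l → h k (suc j) i l *S G′ l)
      ∎

clear-expansion : ∀ k j i N → exBound k j ≤ N →
  clear N (sumL k (λ l → h k j i l ·L block k j l)) ≐ sumS k (λ l → h k j i l *S clear N (block k j l))
clear-expansion k j i N N-large = ≐-trans
  (clear-sumL N k (λ l → h k j i l ·L block k j l))
  (sumS-cong k (λ l _ l≤k → clear-·L N (h k j i l) (block k j l) (≤-trans (ex-block≤exBound k j l l≤k) N-large)))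

expansion-invariant : ∀ k j i → 1 ≤ i → i ≤ k → ∀ N → exBound k j ≤ N →
  clear N (block k 0 i) ≐ clear N (sumL k (λ l → h k j i l ·L block k j l))
expansion-invariant k zero i 1≤i i≤k N N-large = ≐-sym (begin
  clear N (sumL k (λ l → h k 0 i l ·L block k 0 l))
    ≈⟨ clear-expansion k 0 i N N-large ⟩
  sumS k (λ l → guard (i ≡ᵇ l) oneS *S clear N (block k 0 l))
    ≈⟨ sumS-cong k (λ l _ _ → ≐-trans (guard-*S (i ≡ᵇ l) oneS (clear N (block k 0 l)))
                                       (guard-cong (i ≡ᵇ l) (*S-identityˡ (clear N (block k 0 l))))) ⟩
  sumS k (λ l → guard (i ≡ᵇ l) (clear N (block k 0 l)))
    ≈⟨ sumS-guard-≡ᵇ k i (λ l → clear N (block k 0 l)) 1≤i i≤k ⟩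
  clear N (block k 0 i)
    ∎)
expansion-invariant k (suc j) i 1≤i i≤k N N-large = begin
  clear N (block k 0 i)
    ≈⟨ expansion-invariant k j i 1≤i i≤k N N-large′ ⟩
  clear N (sumL k (λ l → h k j i l ·L block k j l))
    ≈⟨ clear-expansion k j i N N-large′ ⟩
  sumS k (λ m → h k j i m *S clear N (block k j m))
    ≈⟨ expansion-step k j N N-large i ⟩
  sumS k (λ l → h k (suc j) i l *S clear N (block k (suc j) l))
    ≈⟨ clear-expansion k (suc j) i N N-large ⟨
  clear N (sumL k (λ l → h k (suc j) i l ·L block k (suc j) l))
    ∎
  where
  N-large′ : exBound k j ≤ N
  N-large′ = ≤-trans (exBound-suc k j) N-large

proposition2p2 : (k : ℕ) → 2 ≤ k → (j : ℕ) →
    ((i l : ℕ) → 1 ≤ i → i ≤ k → 1 ≤ l → l ≤ k → IsNNPoly (h k j i l))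
    × (1 ≤ j → (i l : ℕ) → 1 ≤ i → i ≤ k → 1 ≤ l → l ≤ k →
         h k j i l ≐ matMul k (h k (j ∸ 1)) (A k j) i l)
    × ((i l : ℕ) → 1 ≤ i → i ≤ k → 1 ≤ l → l ≤ k → h k j i l ≐ Aprod k j i l)
    × ((i : ℕ) → 1 ≤ i → i ≤ k →
         block k 0 i ≈L sumL k (λ l → h k j i l ·L block k j l))
proposition2p2 k _ j =
  (λ i l _ _ _ _ → h-IsNNPoly k j i l) ,
  h≐h*A j ,
  (λ i l _ _ 1≤l l≤k → h≐Aprod k j i l 1≤l l≤k) ,
  (λ i 1≤i i≤k → ≈L-fromClear (exBound k j) (expansion-invariant k j i 1≤i i≤k))
  where
  h≐h*A : ∀ j → 1 ≤ j → (i l : ℕ) → 1 ≤ i → i ≤ k → 1 ≤ l → l ≤ k →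
          h k j i l ≐ matMul k (h k (j ∸ 1)) (A k j) i l
  h≐h*A (suc j) _ i l _ _ 1≤l l≤k = h-suc≐h*A k j i l 1≤l l≤k
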